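{- For every $n\geq 3$ there is an orientation of the wheel $W_n$ that admits an SVAL; for $n=3$ this labeling can be taken to be an SV$(n+1,2)$AL, i.e. with subtractive vertex-weights exactly $4,6,8,10$.
   Context: The wheel $W_n$ has vertices $v_0,v_1,\ldots,v_n$, where $v_0$ (the center) is adjacent to each $v_i$, and $v_1,\ldots,v_n$ form a cycle $v_1v_2\cdots v_nv_1$; a directed wheel is $W_n$ with each edge given a direction. For a digraph $G=(V,A)$, a total labeling is a bijection $\lambda:V\cup A\to\{1,2,\ldots,|V|+|A|\}$. For a vertex $x$, $wt^-(x)=\lambda(x)+\sum_{yx\in A}\lambda(yx)-\sum_{xy\in A}\lambda(xy)$. An SVAL is a total labeling whose vertex-weights $wt^-(x)$ are pairwise distinct; an SV$(a,d)$AL is one whose set of vertex-weights is $\{a,a+d,\ldots,a+(|V|-1)d\}$. -}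

module Defs where

open import Data.Nat as ℕ using (ℕ; zero; suc; _<?_; s≤s)
open import Data.Fin using (Fin; zero; suc; toℕ; fromℕ<)
open import Data.Sum using (_⊎_; inj₁; inj₂)
open import Data.Product using (_×_; _,_; proj₁; proj₂; Σ; ∃)
open import Data.Bool using (Bool; true; false; if_then_else_)
open import Data.List using (List; allFin; map; filter; _++_)
open import Data.Integer as ℤ using (ℤ; +_)
open import Data.Integer.Base using (_-_)
open import Data.Fin.Properties using (_≟_)
open import Relation.Nullary using (yes; no)
open import Relation.Binary.PropositionalEquality using (_≡_)
open import Function.Bundles using (Bijection; _⤖_)
open import Function.Definitions using (Injective)

-- Vertices of the wheel W_n : zero is the center v₀, suc i is the rim vertex v_{i+1}.
Vertex : ℕ → Set
Vertex n = Fin (suc n)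

sucMod : ∀ {n} → Fin n → Fin n
sucMod {suc m} i with suc (toℕ i) <? suc m
... | yes p = fromℕ< p
... | no _  = zero

-- Edges of W_n : inj₁ i is the spoke {v₀, v_{i+1}};
--                inj₂ i is the rim edge {v_{i+1}, v_{(i+1 mod n)+1}}.
Edge : ℕ → Set
Edge n = Fin n ⊎ Fin n

ends : ∀ {n} → Edge n → Vertex n × Vertex n
ends (inj₁ i) = zero , suc i
ends (inj₂ i) = suc i , suc (sucMod i)

Orientation : ℕ → Set
Orientation n = Edge n → Bool

tail head : ∀ {n} → Orientation n → Edge n → Vertex n
tail o e = if o e then proj₁ (ends e) else proj₂ (ends e)
head o e = if o e then proj₂ (ends e) else proj₁ (ends e)

allEdges : ∀ n → List (Edge n)
allEdges n = map inj₁ (allFin n) ++ map inj₂ (allFin n)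

-- Elements of V ∪ A, and total labelings: bijections onto {1,…,|V|+|A|}
-- (represented as Fin (|V|+|A|), label = toℕ + 1).
Element : ℕ → Set
Element n = Vertex n ⊎ Edge n

TotalLabeling : ℕ → Set
TotalLabeling n = Element n ⤖ Fin (suc n ℕ.+ (n ℕ.+ n))

lab : ∀ {n} → TotalLabeling n → Element n → ℤ
lab L x = + suc (toℕ (Bijection.to L x))

sumℤ : List ℤ → ℤ
sumℤ = Data.List.foldr ℤ._+_ (+ 0)

wt : ∀ {n} → Orientation n → TotalLabeling n → Vertex n → ℤ
wt {n} o L x =
  (lab L (inj₁ x)
    ℤ.+ sumℤ (map (λ e → lab L (inj₂ e)) (filter (λ e → head o e ≟ x) (allEdges n))))
    - sumℤ (map (λ e → lab L (inj₂ e)) (filter (λ e → tail o e ≟ x) (allEdges n)))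

IsSVAL : ∀ {n} → Orientation n → TotalLabeling n → Set
IsSVAL o L = Injective _≡_ _≡_ (wt o L)

IsSVadAL : ∀ {n} → ℤ → ℤ → Orientation n → TotalLabeling n → Set
IsSVadAL {n} a d o L =
  ((x : Vertex n) → ∃ λ (k : Fin (suc n)) → wt o L x ≡ a ℤ.+ (+ toℕ k) ℤ.* d)
  × ((k : Fin (suc n)) → ∃ λ (x : Vertex n) → wt o L x ≡ a ℤ.+ (+ toℕ k) ℤ.* d)

-- Orient every spoke away from the centre except v₁ → v₀, orient the rim cyclically
-- v₁ → v₂ → ⋯ → vₙ → v₁, and label the vertices v₀,…,vₙ by 1,…,n+1, the spokes by
-- n+2,…,2n+1 and the rim arcs by 2n+2,…,3n+1, in index order. A rim vertex v_{j+2}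
-- gains its spoke and the rim arc before it and loses the rim arc after it, so its
-- weight is n+5+2j; v₁ loses its spoke and the first rim arc but gains the last one,
-- giving weight −1; the centre gains one spoke and loses all the others, so its
-- weight is below −1. For n = 3, reversing every arc and relabelling gives the
-- weights 10, 4, 6, 8, i.e. 4 + 2·predMod v at the vertex v.
module Submission where

open import Defs
open import Data.Nat using (ℕ; _≤_)
open import Data.Integer using (+_)
open import Data.Product using (Σ; _×_)

open import Data.Bool using (true; false)
open import Data.Empty using (⊥-elim)
open import Data.Fin using (Fin; zero; suc; toℕ; fromℕ; inject₁; _↑ˡ_; _↑ʳ_)
open import Data.Fin.Properties as FinP using (_≟_; +↔⊎; suc-injective; toℕ-injective; 0≢1+n)
open import Data.Integer as ℤ using (ℤ; -[1+_]; _⊖_)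
open import Data.Integer.Properties as ℤP using (pos-+; [+m]-[+n]≡m⊖n; +-cancelˡ-⊖)
open import Algebra.Properties.AbelianGroup ℤP.+-0-abelianGroup using (∙-cancelˡ)
open import Data.List using (List; []; _∷_; _++_; map; filter; tabulate)
open import Data.List.Properties using (filter-accept; filter-reject; filter-++; map-++; map-tabulate)
open import Data.Nat as ℕ using (zero; suc; s≤s; _<?_)
open import Data.Nat.ListAction using (sum)
open import Data.Nat.ListAction.Properties using (sum-++)
open import Data.Nat.Properties as ℕP using (+-identityʳ)
open import Data.Nat.Tactic.RingSolver using (solve-∀)
open import Data.Product using (_,_; ∃; proj₁; proj₂)
open import Data.Sum using (_⊎_; inj₁; inj₂)
open import Data.Sum.Function.Propositional using (_⊎-↔_)
open import Function using (_∘_; id)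
open import Function.Bundles using (Bijection; mk↔ₛ′)
open import Function.Definitions using (Injective)
open import Function.Properties.Inverse using (↔⇒⤖; ↔-sym; ↔-trans; ↔-refl)
open import Relation.Binary.PropositionalEquality
open import Relation.Nullary using (¬_; yes; no)
open import Relation.Unary using (Pred; Decidable)

open ≡-Reasoning

module _ {a ℓ} {A : Set a} {P : Pred A ℓ} (P? : Decidable P) (f : A → ℕ) where

  sum-filter-tabulate-none : ∀ {k} (h : Fin k → A) → (∀ i → ¬ P (h i)) →
    sum (map f (filter P? (tabulate h))) ≡ 0
  sum-filter-tabulate-none {zero}  h ¬P = refl
  sum-filter-tabulate-none {suc k} h ¬P
    rewrite filter-reject P? {xs = tabulate (h ∘ suc)} (¬P zero) =
    sum-filter-tabulate-none (h ∘ suc) (¬P ∘ suc)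

  sum-filter-tabulate-unique : ∀ {k} (h : Fin k → A) (i : Fin k) → P (h i) →
    (∀ j → P (h j) → j ≡ i) → sum (map f (filter P? (tabulate h))) ≡ f (h i)
  sum-filter-tabulate-unique h zero Pi unique
    rewrite filter-accept P? {xs = tabulate (h ∘ suc)} Pi =
    trans (cong (f (h zero) ℕ.+_) (sum-filter-tabulate-none (h ∘ suc) λ j Pj → 0≢1+n (sym (unique (suc j) Pj))))
          (+-identityʳ _)
  sum-filter-tabulate-unique h (suc i) Pi unique
    rewrite filter-reject P? {xs = tabulate (h ∘ suc)} (λ P0 → 0≢1+n (unique zero P0)) =
    sum-filter-tabulate-unique (h ∘ suc) i Pi (λ j Pj → suc-injective (unique (suc j) Pj))

sum-map-filter-++ : ∀ {a ℓ} {A : Set a} {P : Pred A ℓ} (P? : Decidable P) (f : A → ℕ) xs ys →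
  sum (map f (filter P? (xs ++ ys))) ≡ sum (map f (filter P? xs)) ℕ.+ sum (map f (filter P? ys))
sum-map-filter-++ P? f xs ys = begin
  sum (map f (filter P? (xs ++ ys)))                    ≡⟨ cong (sum ∘ map f) (filter-++ P? xs ys) ⟩
  sum (map f (filter P? xs ++ filter P? ys))            ≡⟨ cong sum (map-++ f (filter P? xs) _) ⟩
  sum (map f (filter P? xs) ++ map f (filter P? ys))    ≡⟨ sum-++ (map f (filter P? xs)) _ ⟩
  sum (map f (filter P? xs)) ℕ.+ sum (map f (filter P? ys)) ∎

sumℤ-map-+ : ∀ {a} {A : Set a} (f : A → ℕ) (xs : List A) → sumℤ (map (+_ ∘ f) xs) ≡ + sum (map f xs)
sumℤ-map-+ f []       = refl
sumℤ-map-+ f (x ∷ xs) = trans (cong (ℤ._+_ (+ f x)) (sumℤ-map-+ f xs)) (sym (pos-+ (f x) _))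

m≡n+k⇒m⊖n≡+k : ∀ {m n k} → m ≡ n ℕ.+ k → m ⊖ n ≡ + k
m≡n+k⇒m⊖n≡+k {n = n} {k} refl =
  subst (λ z → (n ℕ.+ k) ⊖ z ≡ + k) (+-identityʳ n) (+-cancelˡ-⊖ n k 0)

n≡m+1+k⇒m⊖n≡-[1+k] : ∀ {m n k} → n ≡ m ℕ.+ suc k → m ⊖ n ≡ -[1+ k ]
n≡m+1+k⇒m⊖n≡-[1+k] {m} {k = k} refl =
  subst (λ z → z ⊖ (m ℕ.+ suc k) ≡ -[1+ k ]) (+-identityʳ m) (+-cancelˡ-⊖ m 0 (suc k))

predMod : ∀ {m} → Fin (suc m) → Fin (suc m)
predMod {m}     zero    = fromℕ m
predMod         (suc i) = inject₁ i

toℕ-sucMod : ∀ {m} (i : Fin (suc m)) →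
  toℕ (sucMod i) ≡ suc (toℕ i) ⊎ (toℕ i ≡ m × sucMod i ≡ zero)
toℕ-sucMod {m} i with suc (toℕ i) <? suc m
... | yes i+1<1+m = inj₁ (FinP.toℕ-fromℕ< i+1<1+m)
... | no  i+1≮1+m = inj₂ (ℕP.≤-antisym (ℕ.s≤s⁻¹ (FinP.toℕ<n i)) (ℕ.s≤s⁻¹ (ℕP.≮⇒≥ i+1≮1+m)) , refl)

predMod-sucMod : ∀ {m} (i : Fin (suc m)) → predMod (sucMod i) ≡ i
predMod-sucMod {m} i with sucMod i | toℕ-sucMod i
... | zero   | inj₁ ()
... | suc j  | inj₁ eq = toℕ-injective (trans (FinP.toℕ-inject₁ j) (ℕP.suc-injective eq))
... | _      | inj₂ (i≡m , refl) = toℕ-injective (trans (FinP.toℕ-fromℕ m) (sym i≡m))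

sucMod-predMod : ∀ {m} (j : Fin (suc m)) → sucMod (predMod j) ≡ j
sucMod-predMod {m} zero with toℕ-sucMod (fromℕ m)
... | inj₁ eq       = ⊥-elim (ℕP.<-irrefl (FinP.toℕ-fromℕ m)
                        (ℕ.s≤s⁻¹ (subst (ℕ._< suc m) eq (FinP.toℕ<n (sucMod (fromℕ m))))))
... | inj₂ (_ , eq) = eq
sucMod-predMod         (suc i) with toℕ-sucMod (inject₁ i)
... | inj₁ eq       = toℕ-injective (trans eq (cong suc (FinP.toℕ-inject₁ i)))
... | inj₂ (eq , _) = ⊥-elim (ℕP.<-irrefl (trans (sym (FinP.toℕ-inject₁ i)) eq) (FinP.toℕ<n i))

predMod-injective : ∀ {m} → Injective _≡_ _≡_ (predMod {m})
predMod-injective {x = i} {j} eq = trans (sym (sucMod-predMod i)) (trans (cong sucMod eq) (sucMod-predMod j))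

sucMod≡⇒≡predMod : ∀ {m} {i j : Fin (suc m)} → sucMod i ≡ j → i ≡ predMod j
sucMod≡⇒≡predMod {i = i} refl = sym (predMod-sucMod i)

spokes rims : ∀ n → List (Edge n)
spokes n = tabulate inj₁
rims   n = tabulate inj₂

allEdges≡spokes++rims : ∀ n → allEdges n ≡ spokes n ++ rims n
allEdges≡spokes++rims n = cong₂ _++_ (map-tabulate id inj₁) (map-tabulate id inj₂)

module _ {n} (L : TotalLabeling n) where

  vertexLabel : Vertex n → ℕ
  vertexLabel v = suc (toℕ (Bijection.to L (inj₁ v)))

  arcLabel : Edge n → ℕ
  arcLabel e = suc (toℕ (Bijection.to L (inj₂ e)))

module _ {n} (o : Orientation n) (L : TotalLabeling n) where

  inLabelSum outLabelSum : Vertex n → List (Edge n) → ℕ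
  inLabelSum  x es = sum (map (arcLabel L) (filter (λ e → head o e ≟ x) es))
  outLabelSum x es = sum (map (arcLabel L) (filter (λ e → tail o e ≟ x) es))

  wt≡vertexLabel+in⊖out : ∀ x {v sᵢ rᵢ sₒ rₒ} → vertexLabel L x ≡ v →
    inLabelSum  x (spokes n) ≡ sᵢ → inLabelSum  x (rims n) ≡ rᵢ →
    outLabelSum x (spokes n) ≡ sₒ → outLabelSum x (rims n) ≡ rₒ →
    wt o L x ≡ (v ℕ.+ (sᵢ ℕ.+ rᵢ)) ⊖ (sₒ ℕ.+ rₒ)
  wt≡vertexLabel+in⊖out x refl refl refl refl refl = begin
    wt o L x
      ≡⟨ cong₂ (λ i j → (+ vertexLabel L x ℤ.+ i) ℤ.- j)
           (sumℤ-map-+ (arcLabel L) (filter (λ e → head o e ≟ x) (allEdges n)))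
           (sumℤ-map-+ (arcLabel L) (filter (λ e → tail o e ≟ x) (allEdges n))) ⟩
    (+ vertexLabel L x ℤ.+ + inLabelSum x (allEdges n)) ℤ.- + outLabelSum x (allEdges n)
      ≡⟨ cong (ℤ._- + outLabelSum x (allEdges n)) (sym (pos-+ (vertexLabel L x) _)) ⟩
    + (vertexLabel L x ℕ.+ inLabelSum x (allEdges n)) ℤ.- + outLabelSum x (allEdges n)
      ≡⟨ [+m]-[+n]≡m⊖n (vertexLabel L x ℕ.+ inLabelSum x (allEdges n)) (outLabelSum x (allEdges n)) ⟩
    (vertexLabel L x ℕ.+ inLabelSum x (allEdges n)) ⊖ outLabelSum x (allEdges n)
      ≡⟨ cong₂ (λ es es′ → (vertexLabel L x ℕ.+ inLabelSum x es) ⊖ outLabelSum x es′)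
           (allEdges≡spokes++rims n) (allEdges≡spokes++rims n) ⟩
    (vertexLabel L x ℕ.+ inLabelSum x (spokes n ++ rims n)) ⊖ outLabelSum x (spokes n ++ rims n)
      ≡⟨ cong₂ (λ i j → (vertexLabel L x ℕ.+ i) ⊖ j)
           (sum-map-filter-++ (λ e → head o e ≟ x) (arcLabel L) (spokes n) (rims n))
           (sum-map-filter-++ (λ e → tail o e ≟ x) (arcLabel L) (spokes n) (rims n)) ⟩
    (vertexLabel L x ℕ.+ (inLabelSum x (spokes n) ℕ.+ inLabelSum x (rims n)))
      ⊖ (outLabelSum x (spokes n) ℕ.+ outLabelSum x (rims n)) ∎

  module _ x {v sᵢ rᵢ sₒ rₒ} (v≡ : vertexLabel L x ≡ v)
           (sᵢ≡ : inLabelSum  x (spokes n) ≡ sᵢ) (rᵢ≡ : inLabelSum  x (rims n) ≡ rᵢ)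
           (sₒ≡ : outLabelSum x (spokes n) ≡ sₒ) (rₒ≡ : outLabelSum x (rims n) ≡ rₒ) where

    wt≡+ : ∀ {k} → v ℕ.+ (sᵢ ℕ.+ rᵢ) ≡ (sₒ ℕ.+ rₒ) ℕ.+ k → wt o L x ≡ + k
    wt≡+ balance = trans (wt≡vertexLabel+in⊖out x v≡ sᵢ≡ rᵢ≡ sₒ≡ rₒ≡) (m≡n+k⇒m⊖n≡+k balance)

    wt≡-[1+_] : ∀ {k} → sₒ ℕ.+ rₒ ≡ v ℕ.+ (sᵢ ℕ.+ rᵢ) ℕ.+ suc k → wt o L x ≡ -[1+ k ]
    wt≡-[1+_] balance = trans (wt≡vertexLabel+in⊖out x v≡ sᵢ≡ rᵢ≡ sₒ≡ rₒ≡) (n≡m+1+k⇒m⊖n≡-[1+k] balance)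

wheelOrientation : ∀ n → Orientation n
wheelOrientation n (inj₁ zero)    = false
wheelOrientation n (inj₁ (suc _)) = true
wheelOrientation n (inj₂ _)       = true

wheelLabeling : ∀ n → TotalLabeling n
wheelLabeling n = ↔⇒⤖ (↔-sym (↔-trans (+↔⊎ {suc n}) (↔-refl ⊎-↔ +↔⊎)))

module _ {n : ℕ} where

  vertexLabel-wheel : ∀ v → vertexLabel (wheelLabeling n) v ≡ suc (toℕ v)
  vertexLabel-wheel v = cong suc (FinP.toℕ-↑ˡ v (n ℕ.+ n))

  arcLabel-spoke : ∀ i → arcLabel (wheelLabeling n) (inj₁ i) ≡ suc (suc n ℕ.+ toℕ i)
  arcLabel-spoke i = cong suc (trans (FinP.toℕ-↑ʳ (suc n) (i ↑ˡ n)) (cong (suc n ℕ.+_) (FinP.toℕ-↑ˡ i n)))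

  arcLabel-rim : ∀ i → arcLabel (wheelLabeling n) (inj₂ i) ≡ suc (suc n ℕ.+ (n ℕ.+ toℕ i))
  arcLabel-rim i = cong suc (trans (FinP.toℕ-↑ʳ (suc n) (n ↑ʳ i)) (cong (suc n ℕ.+_) (FinP.toℕ-↑ʳ n i)))

module _ {m : ℕ} where

  private
    n = suc m
    o = wheelOrientation n
    L = wheelLabeling n

  rim-weight : ∀ (j : Fin m) → wt o L (suc (suc j)) ≡ + (n ℕ.+ 5 ℕ.+ 2 ℕ.* toℕ j)
  rim-weight j = wt≡+ o L x (vertexLabel-wheel x)
      (trans (sum-filter-tabulate-unique (λ e → head o e ≟ x) (arcLabel L) inj₁ (suc j) refl spoke-into-x)
             (arcLabel-spoke (suc j)))
      (trans (sum-filter-tabulate-unique (λ e → head o e ≟ x) (arcLabel L) inj₂ (inject₁ j)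
               (cong suc (sucMod-predMod (suc j))) (λ i → sucMod≡⇒≡predMod ∘ suc-injective))
             (trans (arcLabel-rim (inject₁ j)) (cong (λ t → suc (suc n ℕ.+ (n ℕ.+ t))) (FinP.toℕ-inject₁ j))))
      (sum-filter-tabulate-none (λ e → tail o e ≟ x) (arcLabel L) inj₁ no-spoke-from-x)
      (trans (sum-filter-tabulate-unique (λ e → tail o e ≟ x) (arcLabel L) inj₂ (suc j) refl (λ i → suc-injective))
             (arcLabel-rim (suc j)))
    (arithmetic m (toℕ j))
    where
    x = suc (suc j)
    spoke-into-x : ∀ i → head o (inj₁ i) ≡ x → i ≡ suc j
    spoke-into-x (suc i) eq = suc-injective eq
    no-spoke-from-x : ∀ i → ¬ tail o (inj₁ i) ≡ x
    no-spoke-from-x zero    ()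
    no-spoke-from-x (suc i) ()
    arithmetic : ∀ m t → suc (suc (suc t)) ℕ.+ (suc (suc (suc m) ℕ.+ suc t) ℕ.+ suc (suc (suc m) ℕ.+ (suc m ℕ.+ t)))
                 ≡ 0 ℕ.+ suc (suc (suc m) ℕ.+ (suc m ℕ.+ suc t)) ℕ.+ (suc m ℕ.+ 5 ℕ.+ 2 ℕ.* t)
    arithmetic = solve-∀

  first-rim-weight : wt o L (suc zero) ≡ -[1+ 0 ]
  first-rim-weight = wt≡-[1+_] o L x (vertexLabel-wheel x)
    (sum-filter-tabulate-none (λ e → head o e ≟ x) (arcLabel L) inj₁ no-spoke-into-x)
    (trans (sum-filter-tabulate-unique (λ e → head o e ≟ x) (arcLabel L) inj₂ (fromℕ m)
             (cong suc (sucMod-predMod zero)) (λ i → sucMod≡⇒≡predMod ∘ suc-injective))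
           (trans (arcLabel-rim (fromℕ m)) (cong (λ t → suc (suc n ℕ.+ (n ℕ.+ t))) (FinP.toℕ-fromℕ m))))
    (trans (sum-filter-tabulate-unique (λ e → tail o e ≟ x) (arcLabel L) inj₁ zero refl spoke-from-x)
           (arcLabel-spoke {n} zero))
    (trans (sum-filter-tabulate-unique (λ e → tail o e ≟ x) (arcLabel L) inj₂ zero refl (λ i → suc-injective))
           (arcLabel-rim zero))
    (arithmetic m)
    where
    x = suc zero
    no-spoke-into-x : ∀ i → ¬ head o (inj₁ i) ≡ x
    no-spoke-into-x zero    ()
    no-spoke-into-x (suc i) ()
    spoke-from-x : ∀ i → tail o (inj₁ i) ≡ x → i ≡ zero
    spoke-from-x zero _ = refl
    arithmetic : ∀ m → suc (suc (suc m) ℕ.+ 0) ℕ.+ suc (suc (suc m) ℕ.+ (suc m ℕ.+ 0))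
                       ≡ 2 ℕ.+ (0 ℕ.+ suc (suc (suc m) ℕ.+ (suc m ℕ.+ m))) ℕ.+ 1
    arithmetic = solve-∀

centre-weight : ∀ k → let n = 3 ℕ.+ k in
  ∃ λ t → wt (wheelOrientation n) (wheelLabeling n) zero ≡ -[1+ suc t ]
centre-weight k = n ℕ.+ 2 ℕ.+ R ℕ.+ R′ , wt≡-[1+_] o L zero (vertexLabel-wheel {n} zero)
  (trans (sum-filter-tabulate-unique (λ e → head o e ≟ zero) (arcLabel L) inj₁ zero refl spoke-into-centre)
         (arcLabel-spoke {n} zero))
  (sum-filter-tabulate-none (λ e → head o e ≟ zero) (arcLabel L) inj₂ (λ i ()))
  refl refl
  (trans (cong₂ (λ a b → a ℕ.+ (b ℕ.+ R) ℕ.+ R′) (arcLabel-spoke {n} (suc zero)) (arcLabel-spoke {n} (suc (suc zero))))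
         (arithmetic n R R′))
  where
  n = 3 ℕ.+ k
  o = wheelOrientation n
  L = wheelLabeling n
  -- Only the out-spokes to v₂ and v₃ are evaluated; the remaining out-arcs R and R′
  -- merely make the weight more negative.
  R R′ : ℕ
  R  = sum (map (arcLabel L) (filter (λ e → tail o e ≟ zero) (tabulate (λ (i : Fin k) → inj₁ (suc (suc (suc i)))))))
  R′ = outLabelSum o L zero (rims n)
  spoke-into-centre : ∀ i → head o (inj₁ i) ≡ zero → i ≡ zero
  spoke-into-centre zero _ = refl
  arithmetic : ∀ n R R′ → suc (suc n ℕ.+ 1) ℕ.+ (suc (suc n ℕ.+ 2) ℕ.+ R) ℕ.+ R′
               ≡ 1 ℕ.+ (suc (suc n ℕ.+ 0) ℕ.+ 0) ℕ.+ suc (suc (n ℕ.+ 2 ℕ.+ R ℕ.+ R′))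
  arithmetic = solve-∀

wheel-isSVAL : ∀ k → let n = 3 ℕ.+ k in IsSVAL (wheelOrientation n) (wheelLabeling n)
wheel-isSVAL k {x} {y} = separate x y
  where
  n = 3 ℕ.+ k
  W = wt (wheelOrientation n) (wheelLabeling n)
  t = proj₁ (centre-weight k)
  centre : W zero ≡ -[1+ suc t ]
  centre = proj₂ (centre-weight k)
  first-rim : W (suc zero) ≡ -[1+ 0 ]
  first-rim = first-rim-weight {2 ℕ.+ k}
  rim : ∀ j → W (suc (suc j)) ≡ + (n ℕ.+ 5 ℕ.+ 2 ℕ.* toℕ j)
  rim = rim-weight {2 ℕ.+ k}
  rim-injective : ∀ (i j : Fin (2 ℕ.+ k)) → W (suc (suc i)) ≡ W (suc (suc j)) → i ≡ j
  rim-injective i j eq = toℕ-injective (ℕP.*-cancelˡ-≡ (toℕ i) (toℕ j) 2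
    (ℕP.+-cancelˡ-≡ (n ℕ.+ 5) _ _ (ℤP.+-injective (trans (sym (rim i)) (trans eq (rim j))))))
  separate : ∀ x y → W x ≡ W y → x ≡ y
  separate zero          zero          _  = refl
  separate (suc zero)    (suc zero)    _  = refl
  separate (suc (suc i)) (suc (suc j)) eq = cong (λ i → suc (suc i)) (rim-injective i j eq)
  separate zero          (suc zero)    eq with trans (sym centre) (trans eq first-rim)
  ... | ()
  separate (suc zero)    zero          eq with trans (sym first-rim) (trans eq centre)
  ... | ()
  separate zero          (suc (suc j)) eq with trans (sym centre) (trans eq (rim j))
  ... | ()
  separate (suc (suc i)) zero          eq with trans (sym (rim i)) (trans eq centre)
  ... | ()
  separate (suc zero)    (suc (suc j)) eq with trans (sym first-rim) (trans eq (rim j))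
  ... | ()
  separate (suc (suc i)) (suc zero)    eq with trans (sym (rim i)) (trans eq first-rim)
  ... | ()

wheelOrientation₃ : Orientation 3
wheelOrientation₃ _ = false

module _ where
  private
    pattern #0 = zero
    pattern #1 = suc #0
    pattern #2 = suc #1
    pattern #3 = suc #2
    pattern #4 = suc #3
    pattern #5 = suc #4
    pattern #6 = suc #5
    pattern #7 = suc #6
    pattern #8 = suc #7
    pattern #9 = suc #8

    to : Element 3 → Fin 10
    to (inj₁ #0)        = #0
    to (inj₁ #1)        = #7
    to (inj₁ #2)        = #8
    to (inj₁ #3)        = #9
    to (inj₂ (inj₁ #0)) = #1
    to (inj₂ (inj₁ #1)) = #3
    to (inj₂ (inj₁ #2)) = #2
    to (inj₂ (inj₂ #0)) = #4
    to (inj₂ (inj₂ #1)) = #5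
    to (inj₂ (inj₂ #2)) = #6

    from : Fin 10 → Element 3
    from #0 = inj₁ #0
    from #1 = inj₂ (inj₁ #0)
    from #2 = inj₂ (inj₁ #2)
    from #3 = inj₂ (inj₁ #1)
    from #4 = inj₂ (inj₂ #0)
    from #5 = inj₂ (inj₂ #1)
    from #6 = inj₂ (inj₂ #2)
    from #7 = inj₁ #1
    from #8 = inj₁ #2
    from #9 = inj₁ #3

    to-from : ∀ y → to (from y) ≡ y
    to-from #0 = refl
    to-from #1 = refl
    to-from #2 = refl
    to-from #3 = refl
    to-from #4 = refl
    to-from #5 = refl
    to-from #6 = refl
    to-from #7 = refl
    to-from #8 = refl
    to-from #9 = refl

    from-to : ∀ x → from (to x) ≡ x
    from-to (inj₁ #0)        = refl
    from-to (inj₁ #1)        = refl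
    from-to (inj₁ #2)        = refl
    from-to (inj₁ #3)        = refl
    from-to (inj₂ (inj₁ #0)) = refl
    from-to (inj₂ (inj₁ #1)) = refl
    from-to (inj₂ (inj₁ #2)) = refl
    from-to (inj₂ (inj₂ #0)) = refl
    from-to (inj₂ (inj₂ #1)) = refl
    from-to (inj₂ (inj₂ #2)) = refl

  wheelLabeling₃ : TotalLabeling 3
  wheelLabeling₃ = ↔⇒⤖ (mk↔ₛ′ to from to-from from-to)

W₃ : Vertex 3 → ℤ
W₃ = wt wheelOrientation₃ wheelLabeling₃

W₃≡4+2·predMod : ∀ x → W₃ x ≡ + 4 ℤ.+ + toℕ (predMod x) ℤ.* + 2
W₃≡4+2·predMod zero                   = refl
W₃≡4+2·predMod (suc zero)             = refl
W₃≡4+2·predMod (suc (suc zero))       = refl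
W₃≡4+2·predMod (suc (suc (suc zero))) = refl

wheel₃-isSVAL : IsSVAL wheelOrientation₃ wheelLabeling₃
wheel₃-isSVAL {x} {y} eq = predMod-injective (toℕ-injective (ℤP.+-injective
  (ℤP.*-cancelʳ-≡ _ _ (+ 2) (∙-cancelˡ (+ 4) _ _
    (trans (sym (W₃≡4+2·predMod x)) (trans eq (W₃≡4+2·predMod y)))))))

wheel₃-isSVadAL : IsSVadAL (+ 4) (+ 2) wheelOrientation₃ wheelLabeling₃
wheel₃-isSVadAL = (λ x → predMod x , W₃≡4+2·predMod x)
                , (λ k → sucMod k , trans (W₃≡4+2·predMod (sucMod k))
                                          (cong (λ i → + 4 ℤ.+ + toℕ i ℤ.* + 2) (predMod-sucMod k)))

mainTheorem10 : ((n : ℕ) → 3 ≤ n → Σ (Orientation n) λ o → Σ (TotalLabeling n) λ L → IsSVAL o L)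
    × (Σ (Orientation 3) λ o → Σ (TotalLabeling 3) λ L → IsSVAL o L × IsSVadAL (+ 4) (+ 2) o L)
mainTheorem10 = wheel-hasSVAL , wheelOrientation₃ , wheelLabeling₃ , wheel₃-isSVAL , wheel₃-isSVadAL
  where
  wheel-hasSVAL : (n : ℕ) → 3 ≤ n → Σ (Orientation n) λ o → Σ (TotalLabeling n) λ L → IsSVAL o L
  wheel-hasSVAL (suc (suc (suc k))) (s≤s (s≤s (s≤s _))) = wheelOrientation _ , wheelLabeling _ , wheel-isSVAL k
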